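{- The maximum, over all $3$-colorings of $[1,n]$ in which each color class is a single interval of consecutive integers, of the number of rainbow triples $(x,y,z)$ with $x,y,z\in[1,n]$, $x\leq y$ and $x+y<z$ is $Cn^3+O(n^2)$, where $$C=\frac{3\sqrt{3}-5}{6}\approx 0.0326920707.$$ This maximum occurs (asymptotically) in the coloring $\chi(a,b)$ with $a=2-\sqrt{3}$ and $b=\frac{\sqrt{3}-1}{2}$.
   Context: $[1,n]=\{1,\dots,n\}$. A triple is rainbow if its three entries receive three pairwise distinct colors. For real $a,b\geq 0$ with $a+b\leq 1$, $\chi(a,b)$ denotes the $3$-coloring of $[1,n]$ that colors the integers in $[1,an]$ red, the integers in $(an,(a+b)n]$ blue, and the integers in $((a+b)n,n]$ green. -}

module Defs where

open import Data.Nat using (ℕ; zero; suc; _+_; _*_; _∸_; _≤_; _≤ᵇ_; _<ᵇ_)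
open import Data.Bool using (Bool; true; false; if_then_else_; _∧_; not)
open import Data.Fin using (Fin; _≟_)
import Data.Fin as F
open import Data.Integer as ℤ using (ℤ; +_)
open import Data.Sum using (_⊎_)
open import Data.Product using (_×_)
open import Relation.Nullary.Decidable using (⌊_⌋)
open import Relation.Binary.PropositionalEquality using (_≡_)

-- A 3-coloring of [1,n]: only the values on 1..n matter.
Coloring : Set
Coloring = ℕ → Fin 3

IsIntervalColoring : ℕ → Coloring → Set
IsIntervalColoring n c =
  ∀ x y z → 1 ≤ x → x ≤ y → y ≤ z → z ≤ n → c x ≡ c z → c y ≡ c x

sumTo : ℕ → (ℕ → ℕ) → ℕ
sumTo zero    f = 0
sumTo (suc n) f = sumTo n f + f (suc n)

ind : Bool → ℕ
ind true  = 1
ind false = 0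

distinct : Fin 3 → Fin 3 → Bool
distinct i j = not ⌊ i ≟ j ⌋

isRainbow : Fin 3 → Fin 3 → Fin 3 → Bool
isRainbow i j k = distinct i j ∧ distinct j k ∧ distinct i k

rainbowCount : ℕ → Coloring → ℕ
rainbowCount n c =
  sumTo n λ x → sumTo n λ y → sumTo n λ z →
    ind ((x ≤ᵇ y) ∧ (x + y <ᵇ z) ∧ isRainbow (c x) (c y) (c z))

-- Comparisons with √3 · q (q : ℕ) using only integer arithmetic.
-- u ≤ √3·q   iff  u ≤ 0  or  u² ≤ 3 q²
_≤√3*_ : ℤ → ℕ → Set
u ≤√3* q = (u ℤ.≤ + 0) ⊎ (u ℤ.* u ℤ.≤ + (3 * q * q))

-- √3·q ≤ u   iff  0 ≤ u  and  3 q² ≤ u²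
√3*_≤_ : ℕ → ℤ → Set
√3* q ≤ u = (+ 0 ℤ.≤ u) × (+ (3 * q * q) ℤ.≤ u ℤ.* u)

-- The coloring χ(a,b) of [1,n] with a = 2 - √3, b = (√3 - 1)/2, so that
-- a + b = (3 - √3)/2.  For 1 ≤ x ≤ n:
--   x ≤ a n       iff  √3 n ≤ 2n - x   iff  3n² ≤ (2n - x)²   (2n - x ≥ 0)
--   x ≤ (a+b) n   iff  √3 n ≤ 3n - 2x  iff  3n² ≤ (3n - 2x)²  (3n - 2x ≥ 0)
-- Colors: red = 0, blue = 1, green = 2.
chiOpt : ℕ → Coloring
chiOpt n x =
  if (3 * n * n ≤ᵇ (2 * n ∸ x) * (2 * n ∸ x)) then F.zero
  else if (3 * n * n ≤ᵇ (3 * n ∸ 2 * x) * (3 * n ∸ 2 * x)) then F.suc F.zero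
  else F.suc (F.suc F.zero)

-- An interval colouring has classes [1,p], (p,q], (q,n] (some order of the colours), and a
-- rainbow triple x ≤ y, x + y < z must take x, y, z from the first, second and third class
-- respectively.  So the count is at most the number of triples in the "box"
-- x ≤ p < y ≤ q < z, x + y < z, which is p b u (b = q − p, u = n − q) minus at least
-- Σ_{x ≤ m} x(x+1)/2 ≥ m³/6 with m = min(p, b, u).  By AM-GM 4 p b u ≤ m (n − m)², hence
-- 12·count + 10n³ ≤ 3m(n − m)² − 2m³ + 10n³ ≤ 6√3 n³, the last step being a one-variable
-- cubic inequality with an explicit sum-of-squares certificate.  For χ(2 − √3, (√3 − 1)/2)
-- the cuts are roundings of (2 − √3) n and ((3 − √3)/2) n; they satisfy b ≤ u ≤ b + 1 and
-- p ≤ b, every box triple is rainbow, the box count is then exact up to O(n²), and a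
-- polynomial identity turns it into the matching lower bound.

module Submission where

open import Defs
open import Data.Nat using (ℕ; _≤_; _*_)
open import Data.Product using (Σ; _×_; _,_)

module Counting where
  open import Data.Nat hiding (_≟_)
  open import Data.Nat.Properties hiding (_≟_)
  open import Data.Nat.Tactic.RingSolver using (solve-∀)
  open import Algebra.Properties.CommutativeSemigroup *-commutativeSemigroup using (x∙yz≈y∙xz; x∙yz≈z∙xy)
  open import Algebra.Properties.CommutativeSemigroup +-commutativeSemigroup using () renaming (interchange to +-interchange)
  open import Data.Bool using (Bool; true; false; T; _∧_; if_then_else_)
  open import Data.Bool.Properties using (T-∧)
  open import Data.Fin using (_≟_) renaming (zero to fzero; suc to fsuc)
  open import Data.Fin.Properties using (all?)
  open import Data.Product using (_,_; proj₁; proj₂)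
  open import Function.Base using (case_of_)
  open import Function.Bundles using (Equivalence)
  open import Relation.Nullary.Decidable using (from-yes; T?; ¬?; _→-dec_; _×-dec_)
  open import Relation.Unary using (Decidable)
  open import Data.Unit using (tt)
  open import Data.Empty using (⊥; ⊥-elim)
  open import Data.Sum using (inj₁; inj₂; [_,_]′)
  open import Relation.Nullary using (¬_; yes; no)
  open import Relation.Binary.PropositionalEquality
  open ≤-Reasoning

  -- Indicators and sums over [1, n]

  T-∧⁺ : ∀ {a b} → T a → T b → T (a ∧ b)
  T-∧⁺ ta tb = Equivalence.from T-∧ (ta , tb)

  T-∧⁻ : ∀ {a b} → T (a ∧ b) → T a × T b
  T-∧⁻ = Equivalence.to T-∧

  if-T : ∀ {A : Set} {b} {x y : A} → T b → (if b then x else y) ≡ x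
  if-T {b = true} _ = refl

  if-¬T : ∀ {A : Set} {b} {x y : A} → ¬ T b → (if b then x else y) ≡ y
  if-¬T {b = false} _  = refl
  if-¬T {b = true}  ¬t = ⊥-elim (¬t tt)

  ind-true : ∀ {b} → T b → ind b ≡ 1
  ind-true {true} _ = refl

  ind-false : ∀ {b} → ¬ T b → ind b ≡ 0
  ind-false {false} _  = refl
  ind-false {true}  ¬t = ⊥-elim (¬t tt)

  ind-mono : ∀ {a b} → (T a → T b) → ind a ≤ ind b
  ind-mono {false}         _ = z≤n
  ind-mono {true} {true}   _ = ≤-refl
  ind-mono {true} {false}  h = ⊥-elim (h tt)

  ind-≤ᵇ : ∀ {m n} → m ≤ n → ind (m ≤ᵇ n) ≡ 1
  ind-≤ᵇ m≤n = ind-true (≤⇒≤ᵇ m≤n)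

  ind-≰ᵇ : ∀ {m n} → n < m → ind (m ≤ᵇ n) ≡ 0
  ind-≰ᵇ {m} {n} n<m = ind-false λ t → <⇒≱ n<m (≤ᵇ⇒≤ m n t)

  ind-<ᵇ : ∀ {m n} → m < n → ind (m <ᵇ n) ≡ 1
  ind-<ᵇ m<n = ind-true (<⇒<ᵇ m<n)

  ind-≮ᵇ : ∀ {m n} → n ≤ m → ind (m <ᵇ n) ≡ 0
  ind-≮ᵇ {m} {n} n≤m = ind-false λ t → <⇒≱ (<ᵇ⇒< m n t) n≤m

  sumTo-cong : ∀ n {f g : ℕ → ℕ} → (∀ {k} → 1 ≤ k → k ≤ n → f k ≡ g k) → sumTo n f ≡ sumTo n g
  sumTo-cong zero    _  = refl
  sumTo-cong (suc n) eq = cong₂ _+_ (sumTo-cong n λ 1≤k k≤n → eq 1≤k (m≤n⇒m≤1+n k≤n)) (eq (s≤s z≤n) ≤-refl)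

  sumTo-mono : ∀ n {f g : ℕ → ℕ} → (∀ {k} → 1 ≤ k → k ≤ n → f k ≤ g k) → sumTo n f ≤ sumTo n g
  sumTo-mono zero    _  = z≤n
  sumTo-mono (suc n) le = +-mono-≤ (sumTo-mono n λ 1≤k k≤n → le 1≤k (m≤n⇒m≤1+n k≤n)) (le (s≤s z≤n) ≤-refl)

  sumTo-+ : ∀ n (f g : ℕ → ℕ) → sumTo n (λ k → f k + g k) ≡ sumTo n f + sumTo n g
  sumTo-+ zero    f g = refl
  sumTo-+ (suc n) f g =
    trans (cong (_+ (f (suc n) + g (suc n))) (sumTo-+ n f g)) (+-interchange (sumTo n f) (sumTo n g) _ _)

  sumTo-*ˡ : ∀ n c (f : ℕ → ℕ) → sumTo n (λ k → c * f k) ≡ c * sumTo n f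
  sumTo-*ˡ zero    c f = sym (*-zeroʳ c)
  sumTo-*ˡ (suc n) c f = trans (cong (_+ c * f (suc n)) (sumTo-*ˡ n c f)) (sym (*-distribˡ-+ c _ _))

  sumTo-const : ∀ n c → sumTo n (λ _ → c) ≡ n * c
  sumTo-const zero    c = refl
  sumTo-const (suc n) c = trans (cong (_+ c) (sumTo-const n c)) (+-comm (n * c) c)

  sumTo-ind-∧ : ∀ n a (f : ℕ → Bool) → sumTo n (λ k → ind (a ∧ f k)) ≡ ind a * sumTo n (λ k → ind (f k))
  sumTo-ind-∧ n false f = trans (sumTo-const n 0) (*-zeroʳ n)
  sumTo-ind-∧ n true  f = sym (*-identityˡ _)

  sumTo-restrict : ∀ {m} n (g : ℕ → ℕ) → m ≤ n → sumTo n (λ k → ind (k ≤ᵇ m) * g k) ≡ sumTo m g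
  sumTo-restrict {m} n g m≤n with m≤n⇒m<n∨m≡n m≤n
  ... | inj₂ refl = sumTo-cong m λ {k} _ k≤m → trans (cong (_* g k) (ind-≤ᵇ k≤m)) (*-identityˡ (g k))
  sumTo-restrict {m} (suc n) g _ | inj₁ (s≤s m≤n) = begin-equality
    sumTo n (λ k → ind (k ≤ᵇ m) * g k) + ind (suc n ≤ᵇ m) * g (suc n)  ≡⟨ cong₂ _+_ (sumTo-restrict n g m≤n) (cong (_* g (suc n)) (ind-≰ᵇ (s≤s m≤n))) ⟩
    sumTo m g + 0                                                      ≡⟨ +-identityʳ _ ⟩
    sumTo m g                                                          ∎

  sumTo-shift : ∀ p b (g : ℕ → ℕ) → sumTo (p + b) (λ k → ind (p <ᵇ k) * g k) ≡ sumTo b (λ i → g (p + i))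
  sumTo-shift p zero    g = begin-equality
    sumTo (p + 0) (λ k → ind (p <ᵇ k) * g k)  ≡⟨ cong (λ m → sumTo m (λ k → ind (p <ᵇ k) * g k)) (+-identityʳ p) ⟩
    sumTo p (λ k → ind (p <ᵇ k) * g k)        ≡⟨ sumTo-cong p (λ {k} _ k≤p → cong (_* g k) (ind-≮ᵇ k≤p)) ⟩
    sumTo p (λ _ → 0)                         ≡⟨ trans (sumTo-const p 0) (*-zeroʳ p) ⟩
    0                                         ∎
  sumTo-shift p (suc b) g rewrite +-suc p b =
    cong₂ _+_ (sumTo-shift p b g) (trans (cong (_* g (suc (p + b))) (ind-<ᵇ (s≤s (m≤m+n p b)))) (+-identityʳ _))

  sumTo-count-> : ∀ n t → sumTo n (λ k → ind (t <ᵇ k)) ≡ n ∸ t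
  sumTo-count-> zero    t = sym (0∸n≡0 t)
  sumTo-count-> (suc n) t with t ≤? n
  ... | yes t≤n = begin-equality
    sumTo n (λ k → ind (t <ᵇ k)) + ind (t <ᵇ suc n)  ≡⟨ cong₂ _+_ (sumTo-count-> n t) (ind-<ᵇ (s≤s t≤n)) ⟩
    n ∸ t + 1                                        ≡⟨ +-comm (n ∸ t) 1 ⟩
    suc (n ∸ t)                                      ≡⟨ sym (+-∸-assoc 1 t≤n) ⟩
    suc n ∸ t                                        ∎
  ... | no t≰n = begin-equality
    sumTo n (λ k → ind (t <ᵇ k)) + ind (t <ᵇ suc n)  ≡⟨ cong₂ _+_ (sumTo-count-> n t) (ind-≮ᵇ (≰⇒> t≰n)) ⟩
    n ∸ t + 0                                        ≡⟨ cong (_+ 0) (m≤n⇒m∸n≡0 (<⇒≤ (≰⇒> t≰n))) ⟩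
    0                                                ≡⟨ sym (m≤n⇒m∸n≡0 (≰⇒> t≰n)) ⟩
    suc n ∸ t                                        ∎

  triangle : ℕ → ℕ
  triangle x = sumTo x (λ k → k)

  2*triangle : ∀ x → 2 * triangle x ≡ x * suc x
  2*triangle zero    = refl
  2*triangle (suc x) = begin-equality
    2 * (triangle x + suc x)      ≡⟨ *-distribˡ-+ 2 (triangle x) (suc x) ⟩
    2 * triangle x + 2 * suc x    ≡⟨ cong (_+ 2 * suc x) (2*triangle x) ⟩
    x * suc x + 2 * suc x         ≡⟨ step x ⟩
    suc x * suc (suc x)           ∎
    where
    step : ∀ x → x * suc x + 2 * suc x ≡ suc x * suc (suc x)
    step = solve-∀

  6*sumTo-triangle : ∀ m → 6 * sumTo m triangle ≡ m * suc m * suc (suc m)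
  6*sumTo-triangle zero    = refl
  6*sumTo-triangle (suc m) = begin-equality
    6 * (sumTo m triangle + triangle (suc m))            ≡⟨ *-distribˡ-+ 6 (sumTo m triangle) (triangle (suc m)) ⟩
    6 * sumTo m triangle + 6 * triangle (suc m)          ≡⟨ cong (6 * sumTo m triangle +_) (*-assoc 3 2 (triangle (suc m))) ⟩
    6 * sumTo m triangle + 3 * (2 * triangle (suc m))    ≡⟨ cong₂ _+_ (6*sumTo-triangle m) (cong (3 *_) (2*triangle (suc m))) ⟩
    m * suc m * suc (suc m) + 3 * (suc m * suc (suc m))  ≡⟨ step m ⟩
    suc m * suc (suc m) * suc (suc (suc m))              ∎
    where
    step : ∀ m → m * suc m * suc (suc m) + 3 * (suc m * suc (suc m)) ≡ suc m * suc (suc m) * suc (suc (suc m))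
    step = solve-∀

  2m³≤12*sumTo-triangle : ∀ m → 2 * (m * m * m) ≤ 12 * sumTo m triangle
  2m³≤12*sumTo-triangle m = begin
    2 * (m * m * m)                    ≤⟨ *-monoʳ-≤ 2 (*-mono-≤ (*-monoʳ-≤ m (n≤1+n m)) (≤-trans (n≤1+n m) (n≤1+n (suc m)))) ⟩
    2 * (m * suc m * suc (suc m))      ≡⟨ cong (2 *_) (6*sumTo-triangle m) ⟨
    2 * (6 * sumTo m triangle)         ≡⟨ *-assoc 2 6 (sumTo m triangle) ⟨
    12 * sumTo m triangle              ∎

  sumTo-∸-triangle : ∀ k x → sumTo (k + x) (λ i → i ∸ k) ≡ triangle x
  sumTo-∸-triangle k zero rewrite +-identityʳ k =
    trans (sumTo-cong k (λ _ i≤k → m≤n⇒m∸n≡0 i≤k)) (trans (sumTo-const k 0) (*-zeroʳ k))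
  sumTo-∸-triangle k (suc x) rewrite +-suc k x =
    cong₂ _+_ (sumTo-∸-triangle k x) (trans (cong (_∸ k) (sym (+-suc k x))) (m+n∸m≡n k (suc x)))

  sumTo-excess : ∀ {x b} → x ≤ b → sumTo b (λ i → x + i ∸ b) ≡ triangle x
  sumTo-excess {x} {b} x≤b = begin-equality
    sumTo b (λ i → x + i ∸ b)                   ≡⟨ sumTo-cong b (λ {i} _ _ → shift i) ⟩
    sumTo b (λ i → i ∸ (b ∸ x))                 ≡⟨ cong (λ m → sumTo m (λ i → i ∸ (b ∸ x))) (sym (m∸n+n≡m x≤b)) ⟩
    sumTo (b ∸ x + x) (λ i → i ∸ (b ∸ x))       ≡⟨ sumTo-∸-triangle (b ∸ x) x ⟩
    triangle x                                  ∎
    where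
    shift : ∀ i → x + i ∸ b ≡ i ∸ (b ∸ x)
    shift i = trans (cong (x + i ∸_) (sym (m+[n∸m]≡n x≤b))) ([m+n]∸[m+o]≡n∸o x i (b ∸ x))

  sumTo-∸-lower : ∀ n u (f : ℕ → ℕ) → n * u ≤ sumTo n (λ i → u ∸ f i) + sumTo n f
  sumTo-∸-lower n u f = begin
    n * u                                       ≡⟨ sumTo-const n u ⟨
    sumTo n (λ _ → u)                           ≤⟨ sumTo-mono n (λ {i} _ _ → m≤m∸n+n u (f i)) ⟩
    sumTo n (λ i → u ∸ f i + f i)               ≡⟨ sumTo-+ n _ f ⟩
    sumTo n (λ i → u ∸ f i) + sumTo n f         ∎
    where
    m≤m∸n+n : ∀ m n → m ≤ m ∸ n + n
    m≤m∸n+n m n = subst (m ≤_) (+-comm n (m ∸ n)) (m≤n+m∸n m n)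

  sumTo-∸-exact : ∀ n u (f : ℕ → ℕ) → (∀ {i} → 1 ≤ i → i ≤ n → f i ≤ u) →
                  sumTo n (λ i → u ∸ f i) + sumTo n f ≡ n * u
  sumTo-∸-exact n u f f≤u = begin-equality
    sumTo n (λ i → u ∸ f i) + sumTo n f         ≡⟨ sumTo-+ n _ f ⟨
    sumTo n (λ i → u ∸ f i + f i)               ≡⟨ sumTo-cong n (λ 1≤i i≤n → m∸n+n≡m (f≤u 1≤i i≤n)) ⟩
    sumTo n (λ _ → u)                           ≡⟨ sumTo-const n u ⟩
    n * u                                       ∎

  -- Triples in a box

  -- boxRow b u x counts the pairs (y, z) = (p + i, z) with 1 ≤ i ≤ b and
  -- max(q, x + y) < z ≤ n, where q = p + b and n = q + u (see boxTriples≡boxCount-+).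
  boxRow : ℕ → ℕ → ℕ → ℕ
  boxRow b u x = sumTo b λ i → u ∸ (x + i ∸ b)

  boxCount : ℕ → ℕ → ℕ → ℕ
  boxCount p b u = sumTo p (boxRow b u)

  boxRow-≤ : ∀ b u x → boxRow b u x ≤ b * u
  boxRow-≤ b u x = begin
    boxRow b u x         ≤⟨ sumTo-mono b (λ {i} _ _ → m∸n≤m u (x + i ∸ b)) ⟩
    sumTo b (λ _ → u)    ≡⟨ sumTo-const b u ⟩
    b * u                ∎

  boxRow-lower : ∀ {b x} u → x ≤ b → b * u ≤ boxRow b u x + triangle x
  boxRow-lower {b} {x} u x≤b = begin
    b * u                                          ≤⟨ sumTo-∸-lower b u (λ i → x + i ∸ b) ⟩
    boxRow b u x + sumTo b (λ i → x + i ∸ b)       ≡⟨ cong (boxRow b u x +_) (sumTo-excess x≤b) ⟩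
    boxRow b u x + triangle x                      ∎

  boxRow-exact : ∀ {b u x} → x ≤ b → x ≤ u → boxRow b u x + triangle x ≡ b * u
  boxRow-exact {b} {u} {x} x≤b x≤u = begin-equality
    boxRow b u x + triangle x                      ≡⟨ cong (boxRow b u x +_) (sumTo-excess x≤b) ⟨
    boxRow b u x + sumTo b (λ i → x + i ∸ b)       ≡⟨ sumTo-∸-exact b u (λ i → x + i ∸ b) excess≤u ⟩
    b * u                                          ∎
    where
    excess≤u : ∀ {i} → 1 ≤ i → i ≤ b → x + i ∸ b ≤ u
    excess≤u {i} _ i≤b = ≤-trans (∸-monoˡ-≤ b (+-monoʳ-≤ x i≤b)) (≤-trans (≤-reflexive (m+n∸n≡m x b)) x≤u)

  boxCount-upper : ∀ {p b u m} → m ≤ p → m ≤ b → m ≤ u → boxCount p b u + sumTo m triangle ≤ p * (b * u)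
  boxCount-upper {p} {b} {u} {m} m≤p m≤b m≤u = begin
    boxCount p b u + sumTo m triangle                                   ≡⟨ cong (boxCount p b u +_) (sumTo-restrict p triangle m≤p) ⟨
    boxCount p b u + sumTo p (λ x → ind (x ≤ᵇ m) * triangle x)          ≡⟨ sumTo-+ p (boxRow b u) _ ⟨
    sumTo p (λ x → boxRow b u x + ind (x ≤ᵇ m) * triangle x)            ≤⟨ sumTo-mono p (λ {x} _ _ → row x) ⟩
    sumTo p (λ _ → b * u)                                               ≡⟨ sumTo-const p (b * u) ⟩
    p * (b * u)                                                         ∎
    where
    row : ∀ x → boxRow b u x + ind (x ≤ᵇ m) * triangle x ≤ b * u
    row x with x ≤? m
    ... | yes x≤m rewrite ind-≤ᵇ x≤m | *-identityˡ (triangle x) =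
      ≤-reflexive (boxRow-exact (≤-trans x≤m m≤b) (≤-trans x≤m m≤u))
    ... | no x≰m rewrite ind-≰ᵇ (≰⇒> x≰m) | +-identityʳ (boxRow b u x) = boxRow-≤ b u x

  boxCount-lower : ∀ {p b} u → p ≤ b → p * (b * u) ≤ boxCount p b u + sumTo p triangle
  boxCount-lower {p} {b} u p≤b = begin
    p * (b * u)                                         ≡⟨ sumTo-const p (b * u) ⟨
    sumTo p (λ _ → b * u)                               ≤⟨ sumTo-mono p (λ _ x≤p → boxRow-lower u (≤-trans x≤p p≤b)) ⟩
    sumTo p (λ x → boxRow b u x + triangle x)           ≡⟨ sumTo-+ p (boxRow b u) triangle ⟩
    boxCount p b u + sumTo p triangle                   ∎

  InBox : ℕ → ℕ → ℕ → ℕ → ℕ → Bool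
  InBox p q x y z = (x ≤ᵇ p) ∧ (y ≤ᵇ q) ∧ (p <ᵇ y) ∧ (q ⊔ (x + y) <ᵇ z)

  InBox⁺ : ∀ {p q x y z} → x ≤ p → y ≤ q → p < y → q ⊔ (x + y) < z → T (InBox p q x y z)
  InBox⁺ x≤p y≤q p<y max<z = T-∧⁺ (≤⇒≤ᵇ x≤p) (T-∧⁺ (≤⇒≤ᵇ y≤q) (T-∧⁺ (<⇒<ᵇ p<y) (<⇒<ᵇ max<z)))

  InBox⁻ : ∀ {p q x y z} → T (InBox p q x y z) → x ≤ p × y ≤ q × p < y × q ⊔ (x + y) < z
  InBox⁻ {p} {q} {x} {y} {z} t with T-∧⁻ {x ≤ᵇ p} t
  ... | x≤p , t′ with T-∧⁻ {y ≤ᵇ q} t′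
  ...   | y≤q , t″ with T-∧⁻ {p <ᵇ y} t″
  ...     | p<y , max<z = ≤ᵇ⇒≤ x p x≤p , ≤ᵇ⇒≤ y q y≤q , <ᵇ⇒< p y p<y , <ᵇ⇒< (q ⊔ (x + y)) z max<z

  boxTriples : ℕ → ℕ → ℕ → ℕ
  boxTriples p q n = sumTo n λ x → sumTo n λ y → sumTo n λ z → ind (InBox p q x y z)

  [m+n]∸[m⊔o]≡n∸[o∸m] : ∀ m n o → (m + n) ∸ (m ⊔ o) ≡ n ∸ (o ∸ m)
  [m+n]∸[m⊔o]≡n∸[o∸m] zero    n o       = refl
  [m+n]∸[m⊔o]≡n∸[o∸m] (suc m) n zero    = m+n∸m≡n (suc m) n
  [m+n]∸[m⊔o]≡n∸[o∸m] (suc m) n (suc o) = [m+n]∸[m⊔o]≡n∸[o∸m] m n o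

  boxTriples≡boxCount-+ : ∀ p b u → boxTriples p (p + b) (p + b + u) ≡ boxCount p b u
  boxTriples≡boxCount-+ p b u = begin-equality
    boxTriples p q n                                                   ≡⟨ sumTo-cong n (λ {x} _ _ → trans (sumTo-cong n (λ {y} _ _ → sum-z x y)) (sum-y x)) ⟩
    sumTo n (λ x → ind (x ≤ᵇ p) * boxRow b u x)                         ≡⟨ sumTo-restrict n (boxRow b u) (≤-trans (m≤m+n p b) (m≤m+n q u)) ⟩
    boxCount p b u                                                     ∎
    where
    q = p + b
    n = q + u
    gap : ∀ x i → n ∸ (q ⊔ (x + (p + i))) ≡ u ∸ (x + i ∸ b)
    gap x i = begin-equality
      n ∸ (q ⊔ (x + (p + i)))           ≡⟨ [m+n]∸[m⊔o]≡n∸[o∸m] q u (x + (p + i)) ⟩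
      u ∸ (x + (p + i) ∸ (p + b))       ≡⟨ cong (λ t → u ∸ (t ∸ (p + b))) (x+[p+i]≡p+[x+i] x p i) ⟩
      u ∸ (p + (x + i) ∸ (p + b))       ≡⟨ cong (u ∸_) ([m+n]∸[m+o]≡n∸o p (x + i) b) ⟩
      u ∸ (x + i ∸ b)                   ∎
      where
      x+[p+i]≡p+[x+i] : ∀ x p i → x + (p + i) ≡ p + (x + i)
      x+[p+i]≡p+[x+i] = solve-∀
    sum-z : ∀ x y → sumTo n (λ z → ind (InBox p q x y z)) ≡
                    ind (x ≤ᵇ p) * (ind (y ≤ᵇ q) * (ind (p <ᵇ y) * (n ∸ (q ⊔ (x + y)))))
    sum-z x y = begin-equality
      sumTo n (λ z → ind (InBox p q x y z))
        ≡⟨ sumTo-ind-∧ n (x ≤ᵇ p) _ ⟩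
      ind (x ≤ᵇ p) * sumTo n (λ z → ind ((y ≤ᵇ q) ∧ (p <ᵇ y) ∧ (q ⊔ (x + y) <ᵇ z)))
        ≡⟨ cong (ind (x ≤ᵇ p) *_) (sumTo-ind-∧ n (y ≤ᵇ q) _) ⟩
      ind (x ≤ᵇ p) * (ind (y ≤ᵇ q) * sumTo n (λ z → ind ((p <ᵇ y) ∧ (q ⊔ (x + y) <ᵇ z))))
        ≡⟨ cong (λ t → ind (x ≤ᵇ p) * (ind (y ≤ᵇ q) * t)) (sumTo-ind-∧ n (p <ᵇ y) _) ⟩
      ind (x ≤ᵇ p) * (ind (y ≤ᵇ q) * (ind (p <ᵇ y) * sumTo n (λ z → ind (q ⊔ (x + y) <ᵇ z))))
        ≡⟨ cong (λ t → ind (x ≤ᵇ p) * (ind (y ≤ᵇ q) * (ind (p <ᵇ y) * t))) (sumTo-count-> n (q ⊔ (x + y))) ⟩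
      ind (x ≤ᵇ p) * (ind (y ≤ᵇ q) * (ind (p <ᵇ y) * (n ∸ (q ⊔ (x + y)))))
        ∎
    sum-y : ∀ x → sumTo n (λ y → ind (x ≤ᵇ p) * (ind (y ≤ᵇ q) * (ind (p <ᵇ y) * (n ∸ (q ⊔ (x + y))))))
                  ≡ ind (x ≤ᵇ p) * boxRow b u x
    sum-y x = begin-equality
      sumTo n (λ y → ind (x ≤ᵇ p) * (ind (y ≤ᵇ q) * (ind (p <ᵇ y) * (n ∸ (q ⊔ (x + y))))))
        ≡⟨ sumTo-*ˡ n (ind (x ≤ᵇ p)) _ ⟩
      ind (x ≤ᵇ p) * sumTo n (λ y → ind (y ≤ᵇ q) * (ind (p <ᵇ y) * (n ∸ (q ⊔ (x + y)))))
        ≡⟨ cong (ind (x ≤ᵇ p) *_) (sumTo-restrict n _ (m≤m+n q u)) ⟩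
      ind (x ≤ᵇ p) * sumTo q (λ y → ind (p <ᵇ y) * (n ∸ (q ⊔ (x + y))))
        ≡⟨ cong (ind (x ≤ᵇ p) *_) (sumTo-shift p b (λ y → n ∸ (q ⊔ (x + y)))) ⟩
      ind (x ≤ᵇ p) * sumTo b (λ i → n ∸ (q ⊔ (x + (p + i))))
        ≡⟨ cong (ind (x ≤ᵇ p) *_) (sumTo-cong b (λ {i} _ _ → gap x i)) ⟩
      ind (x ≤ᵇ p) * boxRow b u x
        ∎

  boxTriples≡boxCount : ∀ {p q n} → p ≤ q → q ≤ n → boxTriples p q n ≡ boxCount p (q ∸ p) (n ∸ q)
  boxTriples≡boxCount {p} {q} {n} p≤q q≤n =
    subst₂ (λ q′ n′ → boxTriples p q′ n′ ≡ boxCount p (q ∸ p) (n ∸ q))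
      (m+[n∸m]≡n p≤q) (trans (cong (_+ (n ∸ q)) (m+[n∸m]≡n p≤q)) (m+[n∸m]≡n q≤n))
      (boxTriples≡boxCount-+ p (q ∸ p) (n ∸ q))

  -- Interval colourings and cut colourings

  rainbow-distinct : ∀ i j k → T (isRainbow i j k) → i ≢ j × j ≢ k × i ≢ k
  rainbow-distinct = from-yes (all? λ i → all? λ j → all? λ k →
    T? (isRainbow i j k) →-dec (¬? (i ≟ j) ×-dec ¬? (j ≟ k) ×-dec ¬? (i ≟ k)))

  rainbow-hits-every-colour : ∀ i j k e → T (isRainbow i j k) → ¬ (e ≢ i × e ≢ j × e ≢ k)
  rainbow-hits-every-colour = from-yes (all? λ i → all? λ j → all? λ k → all? λ e →
    T? (isRainbow i j k) →-dec ¬? (¬? (e ≟ i) ×-dec ¬? (e ≟ j) ×-dec ¬? (e ≟ k)))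

  rainbowTriple : Coloring → ℕ → ℕ → ℕ → Bool
  rainbowTriple c x y z = (x ≤ᵇ y) ∧ (x + y <ᵇ z) ∧ isRainbow (c x) (c y) (c z)

  rainbowTriple⁺ : ∀ {c x y z} → x ≤ y → x + y < z → T (isRainbow (c x) (c y) (c z)) → T (rainbowTriple c x y z)
  rainbowTriple⁺ x≤y x+y<z rainbow = T-∧⁺ (≤⇒≤ᵇ x≤y) (T-∧⁺ (<⇒<ᵇ x+y<z) rainbow)

  rainbowTriple⁻ : ∀ {c x y z} → T (rainbowTriple c x y z) → x ≤ y × x + y < z × T (isRainbow (c x) (c y) (c z))
  rainbowTriple⁻ {c} {x} {y} {z} t with T-∧⁻ {x ≤ᵇ y} t
  ... | x≤y , t′ with T-∧⁻ {x + y <ᵇ z} t′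
  ...   | x+y<z , rainbow = ≤ᵇ⇒≤ x y x≤y , <ᵇ⇒< (x + y) z x+y<z , rainbow

  DownClosed : ℕ → ℕ → (ℕ → Set) → Set
  DownClosed a n P = ∀ {x y} → a < y → y ≤ x → x ≤ n → P x → P y

  record Segment (a n : ℕ) (P : ℕ → Set) : Set where
    field
      end   : ℕ
      a≤end : a ≤ end
      end≤n : end ≤ n
      holds : ∀ {x} → a < x → x ≤ end → P x
      fails : ∀ {x} → end < x → x ≤ n → ¬ P x

    holds-end : P a → P end
    holds-end Pa with m≤n⇒m<n∨m≡n a≤end
    ... | inj₁ a<end = holds a<end ≤-refl
    ... | inj₂ a≡end = subst P a≡end Pa

  segment : ∀ {a} n {P : ℕ → Set} → Decidable P → a ≤ n → DownClosed a n P → Segment a n P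
  segment zero _ z≤n _ = record
    { end = 0 ; a≤end = z≤n ; end≤n = z≤n
    ; holds = λ 0<x x≤0 → ⊥-elim (<⇒≱ 0<x x≤0) ; fails = λ 0<x x≤0 → ⊥-elim (<⇒≱ 0<x x≤0) }
  segment {a} (suc n) P? a≤1+n down with m≤n⇒m<n∨m≡n a≤1+n
  ... | inj₂ refl = record
    { end = a ; a≤end = ≤-refl ; end≤n = ≤-refl
    ; holds = λ a<x x≤a → ⊥-elim (<⇒≱ a<x x≤a) ; fails = λ a<x x≤a → ⊥-elim (<⇒≱ a<x x≤a) }
  ... | inj₁ (s≤s a≤n) with P? (suc n)
  ...   | yes P[1+n] = record
    { end = suc n ; a≤end = m≤n⇒m≤1+n a≤n ; end≤n = ≤-refl
    ; holds = λ a<x x≤1+n → down a<x x≤1+n ≤-refl P[1+n] ; fails = λ 1+n<x x≤1+n → ⊥-elim (<⇒≱ 1+n<x x≤1+n) }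
  ...   | no ¬P[1+n] = record
    { end = S.end ; a≤end = S.a≤end ; end≤n = m≤n⇒m≤1+n S.end≤n ; holds = S.holds ; fails = fails′ }
    where
    S = segment n P? a≤n (λ a<y y≤x x≤n → down a<y y≤x (m≤n⇒m≤1+n x≤n))
    module S = Segment S
    fails′ : ∀ {x} → S.end < x → x ≤ suc n → ¬ _
    fails′ {x} end<x x≤1+n with m≤n⇒m<n∨m≡n x≤1+n
    ... | inj₁ (s≤s x≤n) = S.fails end<x x≤n
    ... | inj₂ refl      = ¬P[1+n]

  record RainbowBox (n : ℕ) (c : Coloring) : Set where
    field
      p q   : ℕ
      p≤q   : p ≤ q
      q≤n   : q ≤ n
      inBox : ∀ {x y z} → 1 ≤ x → z ≤ n → T (rainbowTriple c x y z) → T (InBox p q x y z)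

  interval-downClosed : ∀ {n c} → IsIntervalColoring n c → ∀ a → DownClosed a n (λ k → c k ≡ c (suc a))
  interval-downClosed interval a a<y y≤x x≤n cx≡ = interval (suc a) _ _ (s≤s z≤n) a<y y≤x x≤n (sym cx≡)

  interval⇒rainbowBox : ∀ {n c} → IsIntervalColoring n c → RainbowBox n c
  interval⇒rainbowBox {n} {c} interval = record
    { p = R.end ; q = B.end ; p≤q = B.a≤end ; q≤n = B.end≤n ; inBox = inBox }
    where
    R = segment n (λ k → c k ≟ c 1) z≤n (interval-downClosed interval 0)
    module R = Segment R
    B = segment n (λ k → c k ≟ c (suc R.end)) R.end≤n (interval-downClosed interval R.end)
    module B = Segment B
    inBox : ∀ {x y z} → 1 ≤ x → z ≤ n → T (rainbowTriple c x y z) → T (InBox R.end B.end x y z)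
    inBox {x} {y} {z} 1≤x z≤n′ t with rainbowTriple⁻ {c} t
    ... | x≤y , x+y<z , rainbow = InBox⁺ x≤p y≤q p<y (⊔-lub q<z x+y<z)
      where
      cx≢cy : c x ≢ c y
      cx≢cy = proj₁ (rainbow-distinct (c x) (c y) (c z) rainbow)
      cy≢cz : c y ≢ c z
      cy≢cz = proj₁ (proj₂ (rainbow-distinct (c x) (c y) (c z) rainbow))
      misses : ∀ e → e ≢ c x → e ≢ c y → e ≢ c z → ⊥
      misses e ≢x ≢y ≢z = rainbow-hits-every-colour (c x) (c y) (c z) e rainbow (≢x , ≢y , ≢z)
      y<z : y < z
      y<z = ≤-<-trans (m≤n+m y x) x+y<z
      y≤n = ≤-trans (<⇒≤ y<z) z≤n′
      x≤p : x ≤ R.end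
      x≤p with x ≤? R.end
      ... | yes x≤p = x≤p
      ... | no  x≰p = ⊥-elim (misses (c 1)
            (λ eq → R.fails p<x (≤-trans x≤y y≤n) (sym eq))
            (λ eq → R.fails (<-≤-trans p<x x≤y) y≤n (sym eq))
            (λ eq → R.fails (<-≤-trans p<x (≤-trans x≤y (<⇒≤ y<z))) z≤n′ (sym eq)))
        where p<x = ≰⇒> x≰p
      p<y : R.end < y
      p<y with y ≤? R.end
      ... | no  y≰p = ≰⇒> y≰p
      ... | yes y≤p = ⊥-elim (cx≢cy (trans (R.holds 1≤x x≤p) (sym (R.holds (≤-trans 1≤x x≤y) y≤p))))
      y≤q : y ≤ B.end
      y≤q with y ≤? B.end
      ... | yes y≤q = y≤q
      ... | no  y≰q = ⊥-elim (misses (c (suc R.end))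
            (λ eq → R.fails ≤-refl (≤-trans p<y y≤n) (trans eq (R.holds 1≤x x≤p)))
            (λ eq → B.fails q<y y≤n (sym eq))
            (λ eq → B.fails (<-trans q<y y<z) z≤n′ (sym eq)))
        where q<y = ≰⇒> y≰q
      q<z : B.end < z
      q<z with z ≤? B.end
      ... | no  z≰q = ≰⇒> z≰q
      ... | yes z≤q = ⊥-elim (cy≢cz (trans (B.holds p<y y≤q) (sym (B.holds (<-trans p<y y<z) z≤q))))

  rainbowCount≤boxTriples : ∀ {n c} (box : RainbowBox n c) →
                            rainbowCount n c ≤ boxTriples (RainbowBox.p box) (RainbowBox.q box) n
  rainbowCount≤boxTriples {n} box =
    sumTo-mono n λ 1≤x _ → sumTo-mono n λ _ _ → sumTo-mono n λ _ z≤n′ → ind-mono (RainbowBox.inBox box 1≤x z≤n′)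

  record IsCutColoring (n p q : ℕ) (c : Coloring) : Set where
    field
      p≤q   : p ≤ q
      q≤n   : q ≤ n
      red   : ∀ {x} → 1 ≤ x → x ≤ p → c x ≡ fzero
      blue  : ∀ {x} → p < x → x ≤ q → c x ≡ fsuc fzero
      green : ∀ {x} → q < x → x ≤ n → c x ≡ fsuc (fsuc fzero)

    not-red : ∀ {x} → p < x → x ≤ n → c x ≢ fzero
    not-red {x} p<x x≤n with x ≤? q
    ... | yes x≤q = λ eq → case trans (sym (blue p<x x≤q)) eq of λ ()
    ... | no  x≰q = λ eq → case trans (sym (green (≰⇒> x≰q) x≤n)) eq of λ ()

    interval : IsIntervalColoring n c
    interval x y z 1≤x x≤y y≤z z≤n′ cx≡cz with y ≤? p | y ≤? q
    ... | yes y≤p | _       = trans (red (≤-trans 1≤x x≤y) y≤p) (sym (red 1≤x (≤-trans x≤y y≤p)))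
    ... | no  y≰p | no  y≰q = trans (green (≰⇒> y≰q) (≤-trans y≤z z≤n′)) (trans (sym (green (<-≤-trans (≰⇒> y≰q) y≤z) z≤n′)) (sym cx≡cz))
    ... | no  y≰p | yes y≤q with x ≤? p
    ...   | yes x≤p = ⊥-elim (not-red (<-≤-trans (≰⇒> y≰p) y≤z) z≤n′ (trans (sym cx≡cz) (red 1≤x x≤p)))
    ...   | no  x≰p = trans (blue (≰⇒> y≰p) y≤q) (sym (blue (≰⇒> x≰p) (≤-trans x≤y y≤q)))

    rainbow : ∀ {x y z} → 1 ≤ x → z ≤ n → T (InBox p q x y z) → T (rainbowTriple c x y z)
    rainbow {x} {y} {z} 1≤x z≤n′ t with InBox⁻ {p} {q} {x} {y} {z} t
    ... | x≤p , y≤q , p<y , max<z = rainbowTriple⁺ {c} (≤-trans x≤p (<⇒≤ p<y)) (≤-<-trans (m≤n⊔m q (x + y)) max<z) rbg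
      where
      rbg : T (isRainbow (c x) (c y) (c z))
      rbg rewrite red 1≤x x≤p | blue p<y y≤q | green (≤-<-trans (m≤m⊔n q (x + y)) max<z) z≤n′ = tt

  boxTriples≤rainbowCount : ∀ {n p q c} → IsCutColoring n p q c → boxTriples p q n ≤ rainbowCount n c
  boxTriples≤rainbowCount {n} cut =
    sumTo-mono n λ 1≤x _ → sumTo-mono n λ _ _ → sumTo-mono n λ _ z≤n′ → ind-mono (IsCutColoring.rainbow cut 1≤x z≤n′)

  -- The upper bound

  4xy≤[x+y]² : ∀ x y → 4 * (x * y) ≤ (x + y) * (x + y)
  4xy≤[x+y]² x y = [ ordered , swapped ]′ (≤-total x y)
    where
    ordered : ∀ {x y} → x ≤ y → 4 * (x * y) ≤ (x + y) * (x + y)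
    ordered {x} {y} x≤y = begin
      4 * (x * y)                                 ≡⟨ cong (λ y → 4 * (x * y)) (sym (m+[n∸m]≡n x≤y)) ⟩
      4 * (x * (x + t))                           ≤⟨ m≤m+n _ (t * t) ⟩
      4 * (x * (x + t)) + t * t                   ≡⟨ square x t ⟩
      (x + (x + t)) * (x + (x + t))               ≡⟨ cong (λ y → (x + y) * (x + y)) (m+[n∸m]≡n x≤y) ⟩
      (x + y) * (x + y)                           ∎
      where
      t = y ∸ x
      square : ∀ x t → 4 * (x * (x + t)) + t * t ≡ (x + (x + t)) * (x + (x + t))
      square = solve-∀
    swapped : y ≤ x → 4 * (x * y) ≤ (x + y) * (x + y)
    swapped y≤x = subst₂ _≤_ (cong (4 *_) (*-comm y x)) (cong (λ t → t * t) (+-comm y x)) (ordered y≤x)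

  record MinSplit (p b u : ℕ) : Set where
    field
      m d   : ℕ
      m≤p   : m ≤ p
      m≤b   : m ≤ b
      m≤u   : m ≤ u
      sum≡  : p + b + u ≡ m + d
      4pbu≤ : 4 * (p * (b * u)) ≤ m * (d * d)

  minSplit-at : ∀ {p b u} m x y → m ≤ p → m ≤ b → m ≤ u →
                p + b + u ≡ m + (x + y) → p * (b * u) ≡ m * (x * y) → MinSplit p b u
  minSplit-at {p} {b} {u} m x y m≤p m≤b m≤u sum≡ prod≡ = record
    { m = m ; d = x + y ; m≤p = m≤p ; m≤b = m≤b ; m≤u = m≤u ; sum≡ = sum≡
    ; 4pbu≤ = begin
        4 * (p * (b * u))            ≡⟨ cong (4 *_) prod≡ ⟩
        4 * (m * (x * y))            ≡⟨ x∙yz≈y∙xz 4 m (x * y) ⟩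
        m * (4 * (x * y))            ≤⟨ *-monoʳ-≤ m (4xy≤[x+y]² x y) ⟩
        m * ((x + y) * (x + y))      ∎ }

  minSplit : ∀ p b u → MinSplit p b u
  minSplit p b u with p ≤? b | p ≤? u | b ≤? u
  ... | yes p≤b | yes p≤u | _       = minSplit-at p b u ≤-refl p≤b p≤u (+-assoc p b u) refl
  ... | no  p≰b | _       | yes b≤u = minSplit-at b p u (<⇒≤ (≰⇒> p≰b)) ≤-refl b≤u
                                        (trans (cong (_+ u) (+-comm p b)) (+-assoc b p u)) (x∙yz≈y∙xz p b u)
  ... | yes p≤b | no  p≰u | _       = minSplit-at u p b (<⇒≤ (≰⇒> p≰u)) (≤-trans (<⇒≤ (≰⇒> p≰u)) p≤b) ≤-refl
                                        (+-comm (p + b) u) (x∙yz≈z∙xy p b u)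
  ... | no  p≰b | _       | no  b≰u = minSplit-at u p b (≤-trans (<⇒≤ (≰⇒> b≰u)) (<⇒≤ (≰⇒> p≰b))) (<⇒≤ (≰⇒> b≰u)) ≤-refl
                                        (+-comm (p + b) u) (x∙yz≈z∙xy p b u)

  cubic : ℕ → ℕ → ℕ
  cubic m d = 8 * (m * m * m) + 30 * (m * m * d) + 33 * (m * d * d) + 10 * (d * d * d)

  -- cubic m d = 3 m d² + 10 n³ − 2 m³ with n = m + d.  With W₁ = m² + n², W₂ = 4mn and
  -- Q = 11m² + 20md + 8d², one has cubic² + (W₁ − W₂)² Q = 108 n⁶; W₁ = W₂ at m = (2 − √3) n.
  cubic²≤108n⁶ : ∀ m d → let n = m + d in cubic m d * cubic m d ≤ 108 * (n * n * n * (n * n * n))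
  cubic²≤108n⁶ m d = +-cancelʳ-≤ ((W₁ + W₂) * (W₁ + W₂) * Q) _ _ (begin
    cubic m d * cubic m d + (W₁ + W₂) * (W₁ + W₂) * Q          ≡⟨ certificate m d ⟩
    108 * (n * n * n * (n * n * n)) + 4 * (W₁ * W₂) * Q        ≤⟨ +-monoʳ-≤ _ (*-monoˡ-≤ Q (4xy≤[x+y]² W₁ W₂)) ⟩
    108 * (n * n * n * (n * n * n)) + (W₁ + W₂) * (W₁ + W₂) * Q  ∎)
    where
    n  = m + d
    W₁ = m * m + n * n
    W₂ = 4 * (m * n)
    Q  = 11 * (m * m) + 20 * (m * d) + 8 * (d * d)
    certificate : ∀ m d →
      (8 * (m * m * m) + 30 * (m * m * d) + 33 * (m * d * d) + 10 * (d * d * d))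
        * (8 * (m * m * m) + 30 * (m * m * d) + 33 * (m * d * d) + 10 * (d * d * d))
        + (m * m + (m + d) * (m + d) + 4 * (m * (m + d))) * (m * m + (m + d) * (m + d) + 4 * (m * (m + d)))
          * (11 * (m * m) + 20 * (m * d) + 8 * (d * d))
      ≡ 108 * ((m + d) * (m + d) * (m + d) * ((m + d) * (m + d) * (m + d)))
        + 4 * ((m * m + (m + d) * (m + d)) * (4 * (m * (m + d)))) * (11 * (m * m) + 20 * (m * d) + 8 * (d * d))
    certificate = solve-∀

  upperBound-arith : ∀ {R m d n} → n ≡ m + d → 12 * R + 2 * (m * m * m) ≤ 3 * (m * (d * d)) →
                     (6 * R + 5 * (n * n * n)) * (6 * R + 5 * (n * n * n)) ≤ 3 * (3 * (n * n * n)) * (3 * (n * n * n))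
  upperBound-arith {R} {m} {d} refl hyp = *-cancelˡ-≤ 4 (begin
    4 * (N * N)                                      ≡⟨ square-double N ⟩
    (2 * N) * (2 * N)                                ≤⟨ *-mono-≤ 2N≤cubic 2N≤cubic ⟩
    cubic m d * cubic m d                            ≤⟨ cubic²≤108n⁶ m d ⟩
    108 * (n * n * n * (n * n * n))                  ≡⟨ split-108 (n * n * n) ⟩
    4 * (3 * (3 * (n * n * n)) * (3 * (n * n * n)))  ∎)
    where
    n = m + d
    N = 6 * R + 5 * (n * n * n)
    square-double : ∀ N → 4 * (N * N) ≡ (2 * N) * (2 * N)
    square-double = solve-∀
    split-108 : ∀ c → 108 * (c * c) ≡ 4 * (3 * (3 * c) * (3 * c))
    split-108 = solve-∀
    expand : ∀ R m d → 2 * (6 * R + 5 * ((m + d) * (m + d) * (m + d))) + 2 * (m * m * m)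
                       ≡ 12 * R + 2 * (m * m * m) + 10 * ((m + d) * (m + d) * (m + d))
    expand = solve-∀
    regroup : ∀ m d → 3 * (m * (d * d)) + 10 * ((m + d) * (m + d) * (m + d))
                      ≡ 8 * (m * m * m) + 30 * (m * m * d) + 33 * (m * d * d) + 10 * (d * d * d) + 2 * (m * m * m)
    regroup = solve-∀
    2N≤cubic : 2 * N ≤ cubic m d
    2N≤cubic = +-cancelʳ-≤ (2 * (m * m * m)) _ _ (begin
      2 * N + 2 * (m * m * m)                        ≡⟨ expand R m d ⟩
      12 * R + 2 * (m * m * m) + 10 * (n * n * n)    ≤⟨ +-monoˡ-≤ (10 * (n * n * n)) hyp ⟩
      3 * (m * (d * d)) + 10 * (n * n * n)           ≡⟨ regroup m d ⟩
      cubic m d + 2 * (m * m * m)                    ∎)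

  rainbowCount-upper : ∀ {n c} → IsIntervalColoring n c →
    let N = 6 * rainbowCount n c + 5 * (n * n * n) in N * N ≤ 3 * (3 * (n * n * n)) * (3 * (n * n * n))
  rainbowCount-upper {n} {c} interval = upperBound-arith {R} {m} {d} n≡m+d (begin
    12 * R + 2 * (m * m * m)                          ≤⟨ +-mono-≤ (*-monoʳ-≤ 12 R≤boxCount) (2m³≤12*sumTo-triangle m) ⟩
    12 * boxCount p b u + 12 * sumTo m triangle       ≡⟨ *-distribˡ-+ 12 (boxCount p b u) (sumTo m triangle) ⟨
    12 * (boxCount p b u + sumTo m triangle)          ≤⟨ *-monoʳ-≤ 12 (boxCount-upper m≤p m≤b m≤u) ⟩
    12 * (p * (b * u))                                ≡⟨ *-assoc 3 4 (p * (b * u)) ⟩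
    3 * (4 * (p * (b * u)))                           ≤⟨ *-monoʳ-≤ 3 4pbu≤ ⟩
    3 * (m * (d * d))                                 ∎)
    where
    R = rainbowCount n c
    box = interval⇒rainbowBox interval
    open RainbowBox box
    b = q ∸ p
    u = n ∸ q
    open MinSplit (minSplit p b u)
    R≤boxCount : R ≤ boxCount p b u
    R≤boxCount = ≤-trans (rainbowCount≤boxTriples box) (≤-reflexive (boxTriples≡boxCount p≤q q≤n))
    n≡m+d : n ≡ m + d
    n≡m+d = trans (sym (trans (cong (_+ u) (m+[n∸m]≡n p≤q)) (m+[n∸m]≡n q≤n))) sum≡

  -- The lower bound

  square-separates : ∀ {K x y} → K ≤ x * x → y * y < K → y < x
  square-separates K≤x² y²<K = ≰⇒> λ x≤y → <⇒≱ y²<K (≤-trans K≤x² (*-mono-≤ x≤y x≤y))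

  square-pred : ∀ s K → (s ∸ 1) * (s ∸ 1) < K → s * s ≤ K + 2 * s
  square-pred zero    K _     = z≤n
  square-pred (suc s) K s²<K = begin
    suc s * suc s          ≡⟨ expand s ⟩
    suc (s * s) + 2 * s    ≤⟨ +-monoˡ-≤ (2 * s) s²<K ⟩
    K + 2 * s              ≤⟨ +-monoʳ-≤ K (*-monoʳ-≤ 2 (n≤1+n s)) ⟩
    K + 2 * suc s          ∎
    where
    expand : ∀ s → suc s * suc s ≡ suc (s * s) + 2 * s
    expand = solve-∀

  n²<3n² : ∀ {n} → 1 ≤ n → n * n < 3 * n * n
  n²<3n² {n} 1≤n = subst (n * n <_) (triple n) (m<m+n (n * n) (≤-trans (s≤s z≤n) (*-monoʳ-≤ 2 (*-mono-≤ 1≤n 1≤n))))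
    where
    triple : ∀ n → n * n + 2 * (n * n) ≡ 3 * n * n
    triple = solve-∀

  3n²≤s²⇒5n<3s : ∀ {n s} → 1 ≤ n → 3 * n * n ≤ s * s → 5 * n < 3 * s
  3n²≤s²⇒5n<3s {n} {s} 1≤n 3n²≤s² = square-separates 27n²≤[3s]² [5n]²<27n²
    where
    27n² : ∀ n → 9 * (3 * n * n) ≡ 27 * (n * n)
    27n² = solve-∀
    9s² : ∀ s → 9 * (s * s) ≡ 3 * s * (3 * s)
    9s² = solve-∀
    25n² : ∀ n → 5 * n * (5 * n) ≡ 25 * (n * n)
    25n² = solve-∀
    25n²+2n² : ∀ n → 25 * (n * n) + 2 * (n * n) ≡ 27 * (n * n)
    25n²+2n² = solve-∀
    27n²≤[3s]² : 27 * (n * n) ≤ 3 * s * (3 * s)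
    27n²≤[3s]² = subst₂ _≤_ (27n² n) (9s² s) (*-monoʳ-≤ 9 3n²≤s²)
    [5n]²<27n² : 5 * n * (5 * n) < 27 * (n * n)
    [5n]²<27n² = subst₂ _<_ (sym (25n² n)) (25n²+2n² n) (m<m+n (25 * (n * n)) (≤-trans (s≤s z≤n) (*-monoʳ-≤ 2 (*-mono-≤ 1≤n 1≤n))))

  -- s = 2n − p and r = 3n − 2q are the integer approximations of √3 n from above produced by the
  -- cuts p ≈ (2 − √3) n and q ≈ ((3 − √3)/2) n of χ; their minimality fixes the shape of the box.
  optimalCut-proportions : ∀ {p b u n s r} → n ≡ p + b + u → s ≡ p + 2 * b + 2 * u → r ≡ p + b + 3 * u → 1 ≤ n →
    3 * n * n ≤ s * s → (s ∸ 1) * (s ∸ 1) < 3 * n * n → 3 * n * n ≤ r * r → (r ∸ 2) * (r ∸ 2) < 3 * n * n →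
    b ≤ u × u ≤ suc b × p ≤ b
  optimalCut-proportions {p} {b} {u} {n} {s} {r} refl refl refl 1≤n 3n²≤s² [s-1]²<3n² 3n²≤r² [r-2]²<3n² =
    b≤u , u≤1+b , p≤b
    where
    s≤r : s ≤ r
    s≤r = ≤-trans (m≤n+m∸n s 1) (square-separates 3n²≤r² [s-1]²<3n²)
    r≤1+s : r ≤ suc s
    r≤1+s = ≤-trans (m≤n+m∸n r 2) (s≤s (square-separates 3n²≤s² [r-2]²<3n²))
    b≤u : b ≤ u
    b≤u = +-cancelˡ-≤ (p + b + 2 * u) b u (subst₂ _≤_ (s-form p b u) (r-form p b u) s≤r)
      where
      s-form : ∀ p b u → p + 2 * b + 2 * u ≡ p + b + 2 * u + b
      s-form = solve-∀
      r-form : ∀ p b u → p + b + 3 * u ≡ p + b + 2 * u + u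
      r-form = solve-∀
    u≤1+b : u ≤ suc b
    u≤1+b = +-cancelˡ-≤ (p + b + 2 * u) u (suc b) (subst₂ _≤_ (r-form p b u) (1+s-form p b u) r≤1+s)
      where
      r-form : ∀ p b u → p + b + 3 * u ≡ p + b + 2 * u + u
      r-form = solve-∀
      1+s-form : ∀ p b u → suc (p + 2 * b + 2 * u) ≡ p + b + 2 * u + suc b
      1+s-form = solve-∀
    p≤b : p ≤ b
    p≤b = *-cancelˡ-≤ 2 (≤-pred (begin
      suc (2 * p)           ≤⟨ +-cancelˡ-< (3 * p + 5 * b + 5 * u) (2 * p) (b + u)
                                 (subst₂ _<_ (5n-form p b u) (3s-form p b u) (3n²≤s²⇒5n<3s {s = p + 2 * b + 2 * u} 1≤n 3n²≤s²)) ⟩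
      b + u                 ≤⟨ +-monoʳ-≤ b u≤1+b ⟩
      b + suc b             ≡⟨ +-suc b b ⟩
      suc (b + b)           ≡⟨ cong suc (cong (b +_) (sym (+-identityʳ b))) ⟩
      suc (2 * b)           ∎))
      where
      5n-form : ∀ p b u → 5 * (p + b + u) ≡ 3 * p + 5 * b + 5 * u + 2 * p
      5n-form = solve-∀
      3s-form : ∀ p b u → 3 * (p + 2 * b + 2 * u) ≡ 3 * p + 5 * b + 5 * u + (b + u)
      3s-form = solve-∀

  -- With s² = 3n² + O(n) and d ≤ 1 this reads 12 p b u = 6 s n² − 10 n³ + 2 p³ − O(n²),
  -- while the box count is p b u − p³/6 − O(n²).
  optimalCut-identity : ∀ {p b d u n s} → u ≡ b + d → n ≡ p + b + u → s ≡ p + 2 * b + 2 * u →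
    12 * (p * (b * u)) + 10 * (n * n * n) + s * (s * s) + 3 * (p * (d * d)) ≡ 9 * (s * (n * n)) + 2 * (p * p * p)
  optimalCut-identity {p} {b} {d} refl refl refl = identity p b d
    where
    identity : ∀ p b d →
      12 * (p * (b * (b + d))) + 10 * ((p + b + (b + d)) * (p + b + (b + d)) * (p + b + (b + d)))
        + (p + 2 * b + 2 * (b + d)) * ((p + 2 * b + 2 * (b + d)) * (p + 2 * b + 2 * (b + d))) + 3 * (p * (d * d))
      ≡ 9 * ((p + 2 * b + 2 * (b + d)) * ((p + b + (b + d)) * (p + b + (b + d)))) + 2 * (p * p * p)
    identity = solve-∀

  lowerOrderTerms≤24n² : ∀ {p d n s e} → 1 ≤ n → p ≤ n → d ≤ 1 → s ≤ 2 * n → e ≤ 2 * s →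
                         6 * (p * p) + 4 * p + s * e + 3 * (p * (d * d)) ≤ 24 * (n * n)
  lowerOrderTerms≤24n² {p} {d} {n} {s} {e} 1≤n p≤n d≤1 s≤2n e≤2s = begin
    6 * (p * p) + 4 * p + s * e + 3 * (p * (d * d))
      ≤⟨ +-mono-≤ (+-mono-≤ (+-mono-≤ (*-monoʳ-≤ 6 (*-mono-≤ p≤n p≤n)) (*-monoʳ-≤ 4 (≤-trans p≤n n≤n²)))
                           (*-mono-≤ s≤2n (≤-trans e≤2s (*-monoʳ-≤ 2 s≤2n))))
                 (*-monoʳ-≤ 3 (*-mono-≤ p≤n (*-mono-≤ d≤1 d≤1))) ⟩
    6 * (n * n) + 4 * (n * n) + 2 * n * (2 * (2 * n)) + 3 * (n * 1)
      ≤⟨ +-monoʳ-≤ (6 * (n * n) + 4 * (n * n) + 2 * n * (2 * (2 * n))) (*-monoʳ-≤ 3 (subst (_≤ n * n) (sym (*-identityʳ n)) n≤n²)) ⟩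
    6 * (n * n) + 4 * (n * n) + 2 * n * (2 * (2 * n)) + 3 * (n * n)
      ≡⟨ collect n ⟩
    21 * (n * n)
      ≤⟨ *-monoˡ-≤ (n * n) (m≤m+n 21 3) ⟩
    24 * (n * n)  ∎
    where
    n≤n² : n ≤ n * n
    n≤n² = subst (_≤ n * n) (*-identityʳ n) (*-monoʳ-≤ n 1≤n)
    collect : ∀ n → 6 * (n * n) + 4 * (n * n) + 2 * n * (2 * (2 * n)) + 3 * (n * n) ≡ 21 * (n * n)
    collect = solve-∀

  lowerBound-arith : ∀ {R p b d u n s} → u ≡ b + d → d ≤ 1 → n ≡ p + b + u → s ≡ p + 2 * b + 2 * u → 1 ≤ n →
    3 * n * n ≤ s * s → s * s ≤ 3 * n * n + 2 * s →
    12 * (p * (b * u)) ≤ 12 * R + 2 * (p * suc p * suc (suc p)) →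
    3 * s * (n * n) ≤ 6 * R + 5 * (n * n * n) + 12 * (n * n)
  lowerBound-arith {R} {p} {b} {d} {u} {n} {s} u≡ d≤1 n≡ s≡ 1≤n 3n²≤s² s²≤ 12pbu≤ =
    *-cancelˡ-≤ 2 (+-cancelˡ-≤ X (2 * (3 * s * (n * n))) (2 * (6 * R + 5 * (n * n * n) + 12 * (n * n))) (begin
      X + 2 * (3 * s * (n * n))
        ≡⟨ regroup-left s n p ⟩
      9 * (s * (n * n)) + 2 * (p * p * p)
        ≡⟨ optimalCut-identity {p} {b} {d} u≡ n≡ s≡ ⟨
      12 * (p * (b * u)) + 10 * (n * n * n) + s * (s * s) + 3 * (p * (d * d))
        ≡⟨ cong (λ t → 12 * (p * (b * u)) + 10 * (n * n * n) + s * t + 3 * (p * (d * d))) s²≡ ⟩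
      12 * (p * (b * u)) + 10 * (n * n * n) + s * (3 * n * n + e) + 3 * (p * (d * d))
        ≤⟨ +-monoˡ-≤ _ (+-monoˡ-≤ _ (+-monoˡ-≤ _ 12pbu≤)) ⟩
      12 * R + 2 * (p * suc p * suc (suc p)) + 10 * (n * n * n) + s * (3 * n * n + e) + 3 * (p * (d * d))
        ≡⟨ regroup-right R p n s e d ⟩
      X + (12 * R + 10 * (n * n * n) + (6 * (p * p) + 4 * p + s * e + 3 * (p * (d * d))))
        ≤⟨ +-monoʳ-≤ X (+-monoʳ-≤ (12 * R + 10 * (n * n * n)) (lowerOrderTerms≤24n² 1≤n p≤n d≤1 s≤2n e≤2s)) ⟩
      X + (12 * R + 10 * (n * n * n) + 24 * (n * n))
        ≡⟨ cong (X +_) (double R n) ⟩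
      X + 2 * (6 * R + 5 * (n * n * n) + 12 * (n * n))
        ∎))
    where
    X = 3 * (s * (n * n)) + 2 * (p * p * p)
    e = s * s ∸ 3 * n * n
    s²≡ : s * s ≡ 3 * n * n + e
    s²≡ = sym (m+[n∸m]≡n 3n²≤s²)
    regroup-left : ∀ s n p → 3 * (s * (n * n)) + 2 * (p * p * p) + 2 * (3 * s * (n * n)) ≡ 9 * (s * (n * n)) + 2 * (p * p * p)
    regroup-left = solve-∀
    regroup-right : ∀ R p n s e d →
      12 * R + 2 * (p * suc p * suc (suc p)) + 10 * (n * n * n) + s * (3 * n * n + e) + 3 * (p * (d * d))
      ≡ 3 * (s * (n * n)) + 2 * (p * p * p) + (12 * R + 10 * (n * n * n) + (6 * (p * p) + 4 * p + s * e + 3 * (p * (d * d))))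
    regroup-right = solve-∀
    double : ∀ R n → 12 * R + 10 * (n * n * n) + 24 * (n * n) ≡ 2 * (6 * R + 5 * (n * n * n) + 12 * (n * n))
    double = solve-∀
    p≤n : p ≤ n
    p≤n = subst (p ≤_) (sym n≡) (≤-trans (m≤m+n p b) (m≤m+n (p + b) u))
    s≤2n : s ≤ 2 * n
    s≤2n = subst₂ _≤_ (sym s≡) (trans (2n-form p b u) (cong (2 *_) (sym n≡))) (m≤n+m (p + 2 * b + 2 * u) p)
      where
      2n-form : ∀ p b u → p + (p + 2 * b + 2 * u) ≡ 2 * (p + b + u)
      2n-form = solve-∀
    e≤2s : e ≤ 2 * s
    e≤2s = subst (e ≤_) (m+n∸m≡n (3 * n * n) (2 * s)) (∸-monoˡ-≤ (3 * n * n) s²≤)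
  squareBound-downClosed : ∀ {a n K} (f : ℕ → ℕ) → (∀ {x y} → x ≤ y → f y ≤ f x) → DownClosed a n (λ x → K ≤ f x * f x)
  squareBound-downClosed f antitone _ y≤x _ K≤ = ≤-trans K≤ (*-mono-≤ (antitone y≤x) (antitone y≤x))

  module OptimalColoring (n : ℕ) (1≤n : 1 ≤ n) where

    RedTest BlueTest : ℕ → Set
    RedTest  x = 3 * n * n ≤ (2 * n ∸ x) * (2 * n ∸ x)
    BlueTest x = 3 * n * n ≤ (3 * n ∸ 2 * x) * (3 * n ∸ 2 * x)

    Red : Segment 0 n RedTest
    Red = segment n (λ x → 3 * n * n ≤? (2 * n ∸ x) * (2 * n ∸ x)) z≤n
            (squareBound-downClosed (2 * n ∸_) (∸-monoʳ-≤ (2 * n)))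
    module Red = Segment Red

    p : ℕ
    p = Red.end

    Blue : Segment p n BlueTest
    Blue = segment n (λ x → 3 * n * n ≤? (3 * n ∸ 2 * x) * (3 * n ∸ 2 * x)) Red.end≤n
             (squareBound-downClosed (λ x → 3 * n ∸ 2 * x) (λ x≤y → ∸-monoʳ-≤ (3 * n) (*-monoʳ-≤ 2 x≤y)))
    module Blue = Segment Blue

    q : ℕ
    q = Blue.end

    red⇒blue : ∀ {x} → x ≤ n → RedTest x → BlueTest x
    red⇒blue {x} x≤n red = ≤-trans red (*-mono-≤ gap≤ gap≤)
      where
      t = n ∸ x
      2n-x : 2 * (x + t) ∸ x ≡ x + 2 * t
      2n-x = trans (cong (_∸ x) (split x t)) (m+n∸m≡n x (x + 2 * t))
        where
        split : ∀ x t → 2 * (x + t) ≡ x + (x + 2 * t)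
        split = solve-∀
      3n-2x : 3 * (x + t) ∸ 2 * x ≡ x + 3 * t
      3n-2x = trans (cong (_∸ 2 * x) (split x t)) (m+n∸m≡n (2 * x) (x + 3 * t))
        where
        split : ∀ x t → 3 * (x + t) ≡ 2 * x + (x + 3 * t)
        split = solve-∀
      gap≤ : 2 * n ∸ x ≤ 3 * n ∸ 2 * x
      gap≤ = subst (λ n → 2 * n ∸ x ≤ 3 * n ∸ 2 * x) (m+[n∸m]≡n x≤n)
               (subst₂ _≤_ (sym 2n-x) (sym 3n-2x) (+-monoʳ-≤ x (*-monoˡ-≤ t (n≤1+n 2))))

    RedTest-0 : RedTest 0
    RedTest-0 = subst (3 * n * n ≤_) (four n) (m≤m+n (3 * n * n) (n * n))
      where
      four : ∀ n → 3 * n * n + n * n ≡ 2 * n * (2 * n)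
      four = solve-∀

    ¬RedTest-n : ¬ RedTest n
    ¬RedTest-n red = <⇒≱ (n²<3n² 1≤n) (subst (λ t → 3 * n * n ≤ t * t) (m+n∸n≡m n n) red′)
      where
      red′ : 3 * n * n ≤ (n + n ∸ n) * (n + n ∸ n)
      red′ = subst (λ t → 3 * n * n ≤ (t ∸ n) * (t ∸ n)) (cong (n +_) (+-identityʳ n)) red

    ¬BlueTest-n : ¬ BlueTest n
    ¬BlueTest-n blue = <⇒≱ (n²<3n² 1≤n) (subst (λ t → 3 * n * n ≤ t * t) 3n-2n blue)
      where
      split : ∀ n → 3 * n ≡ 2 * n + n
      split = solve-∀
      3n-2n : 3 * n ∸ 2 * n ≡ n
      3n-2n = trans (cong (_∸ 2 * n) (split n)) (m+n∸m≡n (2 * n) n)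

    RedTest-p : RedTest p
    RedTest-p = Red.holds-end RedTest-0

    BlueTest-q : BlueTest q
    BlueTest-q = Blue.holds-end (red⇒blue Red.end≤n RedTest-p)

    p<n : p < n
    p<n = ≤∧≢⇒< Red.end≤n λ p≡n → ¬RedTest-n (subst RedTest p≡n RedTest-p)

    q<n : q < n
    q<n = ≤∧≢⇒< Blue.end≤n λ q≡n → ¬BlueTest-n (subst BlueTest q≡n BlueTest-q)

    isCutColoring : IsCutColoring n p q (chiOpt n)
    isCutColoring = record
      { p≤q   = Blue.a≤end
      ; q≤n   = Blue.end≤n
      ; red   = λ 1≤x x≤p → if-T (≤⇒≤ᵇ (Red.holds 1≤x x≤p))
      ; blue  = λ p<x x≤q → trans (if-¬T (not-red p<x (≤-trans x≤q Blue.end≤n))) (if-T (≤⇒≤ᵇ (Blue.holds p<x x≤q)))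
      ; green = λ q<x x≤n → trans (if-¬T (not-red (≤-<-trans Blue.a≤end q<x) x≤n)) (if-¬T (not-blue q<x x≤n))
      }
      where
      not-red : ∀ {x} → p < x → x ≤ n → ¬ T (3 * n * n ≤ᵇ (2 * n ∸ x) * (2 * n ∸ x))
      not-red p<x x≤n t = Red.fails p<x x≤n (≤ᵇ⇒≤ _ _ t)
      not-blue : ∀ {x} → q < x → x ≤ n → ¬ T (3 * n * n ≤ᵇ (3 * n ∸ 2 * x) * (3 * n ∸ 2 * x))
      not-blue q<x x≤n t = Blue.fails q<x x≤n (≤ᵇ⇒≤ _ _ t)

    b u s r : ℕ
    b = q ∸ p
    u = n ∸ q
    s = 2 * n ∸ p
    r = 3 * n ∸ 2 * q

    q≡p+b : q ≡ p + b
    q≡p+b = sym (m+[n∸m]≡n Blue.a≤end)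

    n≡p+b+u : n ≡ p + b + u
    n≡p+b+u = trans (sym (m+[n∸m]≡n Blue.end≤n)) (cong (_+ u) q≡p+b)

    s≡ : s ≡ p + 2 * b + 2 * u
    s≡ = trans (cong (λ n → 2 * n ∸ p) n≡p+b+u) (trans (cong (_∸ p) (split p b u)) (m+n∸m≡n p _))
      where
      split : ∀ p b u → 2 * (p + b + u) ≡ p + (p + 2 * b + 2 * u)
      split = solve-∀

    r≡ : r ≡ p + b + 3 * u
    r≡ = trans (cong₂ (λ n q → 3 * n ∸ 2 * q) n≡p+b+u q≡p+b)
               (trans (cong (_∸ 2 * (p + b)) (split p b u)) (m+n∸m≡n (2 * (p + b)) _))
      where
      split : ∀ p b u → 3 * (p + b + u) ≡ 2 * (p + b) + (p + b + 3 * u)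
      split = solve-∀

    [s-1]²<3n² : (s ∸ 1) * (s ∸ 1) < 3 * n * n
    [s-1]²<3n² = subst (λ t → t * t < 3 * n * n) (sym s-1≡) (≰⇒> (Red.fails ≤-refl p<n))
      where
      s-1≡ : s ∸ 1 ≡ 2 * n ∸ suc p
      s-1≡ = trans (∸-+-assoc (2 * n) p 1) (cong (2 * n ∸_) (+-comm p 1))

    [r-2]²<3n² : (r ∸ 2) * (r ∸ 2) < 3 * n * n
    [r-2]²<3n² = subst (λ t → t * t < 3 * n * n) (sym r-2≡) (≰⇒> (Blue.fails ≤-refl q<n))
      where
      2q+2 : ∀ q → 2 * q + 2 ≡ 2 * suc q
      2q+2 = solve-∀
      r-2≡ : r ∸ 2 ≡ 3 * n ∸ 2 * suc q
      r-2≡ = trans (∸-+-assoc (3 * n) (2 * q) 2) (cong (3 * n ∸_) (2q+2 q))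

    proportions : b ≤ u × u ≤ suc b × p ≤ b
    proportions = optimalCut-proportions n≡p+b+u s≡ r≡ 1≤n RedTest-p [s-1]²<3n² BlueTest-q [r-2]²<3n²

    12pbu≤ : let R = rainbowCount n (chiOpt n) in 12 * (p * (b * u)) ≤ 12 * R + 2 * (p * suc p * suc (suc p))
    12pbu≤ = begin
      12 * (p * (b * u))                            ≤⟨ *-monoʳ-≤ 12 (boxCount-lower u (proj₂ (proj₂ proportions))) ⟩
      12 * (boxCount p b u + sumTo p triangle)      ≡⟨ *-distribˡ-+ 12 (boxCount p b u) (sumTo p triangle) ⟩
      12 * boxCount p b u + 12 * sumTo p triangle   ≤⟨ +-monoˡ-≤ _ (*-monoʳ-≤ 12 boxCount≤R) ⟩
      12 * R + 12 * sumTo p triangle                ≡⟨ cong (12 * R +_) (trans (*-assoc 2 6 (sumTo p triangle)) (cong (2 *_) (6*sumTo-triangle p))) ⟩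
      12 * R + 2 * (p * suc p * suc (suc p))        ∎
      where
      R = rainbowCount n (chiOpt n)
      boxCount≤R : boxCount p b u ≤ R
      boxCount≤R = ≤-trans (≤-reflexive (sym (boxTriples≡boxCount Blue.a≤end Blue.end≤n))) (boxTriples≤rainbowCount isCutColoring)

    rainbowCount-lower : let Y = 6 * rainbowCount n (chiOpt n) + 5 * (n * n * n) + 12 * (n * n) in
                         3 * (3 * (n * n * n)) * (3 * (n * n * n)) ≤ Y * Y
    rainbowCount-lower = begin
      3 * (3 * (n * n * n)) * (3 * (n * n * n))  ≡⟨ regroup-left n ⟩
      9 * (3 * n * n) * (n * n * (n * n))        ≤⟨ *-monoˡ-≤ (n * n * (n * n)) (*-monoʳ-≤ 9 RedTest-p) ⟩
      9 * (s * s) * (n * n * (n * n))            ≡⟨ regroup-right s n ⟩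
      3 * s * (n * n) * (3 * s * (n * n))        ≤⟨ *-mono-≤ 3sn²≤Y 3sn²≤Y ⟩
      Y * Y                                      ∎
      where
      Y = 6 * rainbowCount n (chiOpt n) + 5 * (n * n * n) + 12 * (n * n)
      regroup-left : ∀ n → 3 * (3 * (n * n * n)) * (3 * (n * n * n)) ≡ 9 * (3 * n * n) * (n * n * (n * n))
      regroup-left = solve-∀
      regroup-right : ∀ s n → 9 * (s * s) * (n * n * (n * n)) ≡ 3 * s * (n * n) * (3 * s * (n * n))
      regroup-right = solve-∀
      b≤u = proj₁ proportions
      d≤1 : u ∸ b ≤ 1
      d≤1 = subst (u ∸ b ≤_) (m+n∸n≡m 1 b) (∸-monoˡ-≤ b (proj₁ (proj₂ proportions)))
      3sn²≤Y : 3 * s * (n * n) ≤ Y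
      3sn²≤Y = lowerBound-arith {rainbowCount n (chiOpt n)} (sym (m+[n∸m]≡n b≤u)) d≤1 n≡p+b+u s≡ 1≤n RedTest-p
                 (square-pred s (3 * n * n) [s-1]²<3n²) 12pbu≤

open Counting using (rainbowCount-upper; module IsCutColoring; module OptimalColoring)
open import Data.Integer using (+_; _+_; _-_; +≤+)
import Data.Integer as ℤ
open import Data.Integer.Properties using (pos-+; pos-*; m-n≡m⊖n; ⊖-≤; ⊖-≥; neg-≤-pos)
import Data.Nat as ℕ
import Data.Nat.Properties as ℕ
open import Data.Sum using (inj₁; inj₂)
open import Relation.Binary.PropositionalEquality using (sym; subst)

≤√3*-fromℕ : ∀ a b c q → (a ℕ.+ b) * (a ℕ.+ b) ≤ 3 * q * q → ((+ a + + b) - + c) ≤√3* q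
≤√3*-fromℕ a b c q a+b≤√3q rewrite sym (pos-+ a b) | m-n≡m⊖n (a ℕ.+ b) c with ℕ.≤-total (a ℕ.+ b) c
... | inj₁ a+b≤c rewrite ⊖-≤ a+b≤c = inj₁ neg-≤-pos
... | inj₂ c≤a+b rewrite ⊖-≥ c≤a+b =
  inj₂ (subst (ℤ._≤ + (3 * q * q)) (pos-* (a ℕ.+ b ℕ.∸ c) (a ℕ.+ b ℕ.∸ c))
    (+≤+ (ℕ.≤-trans (ℕ.*-mono-≤ (ℕ.m∸n≤m (a ℕ.+ b) c) (ℕ.m∸n≤m (a ℕ.+ b) c)) a+b≤√3q)))

√3*≤-fromℕ : ∀ a b c q → 3 * q * q ≤ (a ℕ.+ b ℕ.+ c) * (a ℕ.+ b ℕ.+ c) → √3* q ≤ ((+ a + + b) + + c)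
√3*≤-fromℕ a b c q √3q≤a+b+c rewrite sym (pos-+ a b) | sym (pos-+ (a ℕ.+ b) c) =
  +≤+ ℕ.z≤n , subst (+ (3 * q * q) ℤ.≤_) (pos-* (a ℕ.+ b ℕ.+ c) (a ℕ.+ b ℕ.+ c)) (+≤+ √3q≤a+b+c)

theorem5p5 : Σ ℕ λ K → Σ ℕ λ N → ∀ n → N ≤ n →
    ((c : Coloring) → IsIntervalColoring n c →
       ((+ (6 * rainbowCount n c) + + (5 * (n * n * n))) - + (6 * K * (n * n)))
         ≤√3* (3 * (n * n * n)))
  × IsIntervalColoring n (chiOpt n)
  × (√3* (3 * (n * n * n)) ≤
       ((+ (6 * rainbowCount n (chiOpt n)) + + (5 * (n * n * n))) + + (6 * K * (n * n))))
theorem5p5 = 2 , 1 , λ n 1≤n →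
    (λ c interval → ≤√3*-fromℕ (6 * rainbowCount n c) (5 * (n * n * n)) (12 * (n * n)) (3 * (n * n * n))
                                (rainbowCount-upper interval))
  , IsCutColoring.interval (OptimalColoring.isCutColoring n 1≤n)
  , √3*≤-fromℕ (6 * rainbowCount n (chiOpt n)) (5 * (n * n * n)) (12 * (n * n)) (3 * (n * n * n))
               (OptimalColoring.rainbowCount-lower n 1≤n)
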